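{- Let $X=\mathrm{Fl}(a,b;n)$, let $v$ be any 012-string for $X$ and let $\mathbf{0}=(0^a,1^{b-a},2^{n-b})$. Then there exists a unique triangular puzzle whose left side reads $\mathbf{0}$ in clockwise direction and whose right side reads $v$ in clockwise direction. The bottom side of this unique puzzle reads $v$ in counter-clockwise direction.
   Context: A 012-string for $\mathrm{Fl}(a,b;n)$ is a vector of length $n$ with $a$ zeros, $b-a$ ones and $n-b$ twos. Puzzles: labels are integers in $\{0,\dots,7\}$. Take an equilateral triangle of side $n$ with horizontal bottom side, subdivided into unit equilateral triangles. A triangular puzzle is an assignment of labels to all unit edges such that for every unit triangle the three edge labels read clockwise around it form a cyclic rotation of one of $(0,0,0),(1,1,1),(2,2,2),(1,0,3),(2,1,4),(2,0,5),(2,3,6),(4,0,7)$. Left side read clockwise: from bottom-left corner to top corner; right side read clockwise: from top corner to bottom-right corner; bottom side read counter-clockwise: from bottom-left corner to bottom-right corner. -}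

module Defs where

open import Data.Nat using (ℕ; zero; suc; _≤_; _<_; _∸_)
open import Data.Fin using (Fin; toℕ; #_; _↑ˡ_)
open import Data.Fin.Properties using (_≟_)
open import Data.Vec using (Vec; lookup; count)
open import Data.Product using (Σ; _×_; _,_)
open import Data.Sum using (_⊎_)
open import Relation.Binary.PropositionalEquality using (_≡_)

Label : Set
Label = Fin 8

embed : Fin 3 → Label
embed c = c ↑ˡ 5

data Basic : Label → Label → Label → Set where
  t000 : Basic (# 0) (# 0) (# 0)
  t111 : Basic (# 1) (# 1) (# 1)
  t222 : Basic (# 2) (# 2) (# 2)
  t103 : Basic (# 1) (# 0) (# 3)
  t214 : Basic (# 2) (# 1) (# 4)
  t205 : Basic (# 2) (# 0) (# 5)
  t236 : Basic (# 2) (# 3) (# 6)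
  t407 : Basic (# 4) (# 0) (# 7)

Allowed : Label → Label → Label → Set
Allowed x y z = Basic x y z ⊎ (Basic y z x ⊎ Basic z x y)

-- Geometry (triangle of side n, apex on top, bottom side horizontal).
-- Horizontal line r (r = 0 is the apex, r = n the bottom side) carries r unit
-- edges, H r j (0 ≤ j < r), numbered left to right.
-- Strip r (0 ≤ r < n, between lines r and r+1) contains up-triangles (r,j),
-- 0 ≤ j ≤ r, and down-triangles (r,j), 0 ≤ j < r.
-- S r j : the "/" edge which is the left side of up-triangle (r,j)   (0 ≤ j ≤ r)
-- B r j : the "\" edge which is the right side of up-triangle (r,j)  (0 ≤ j ≤ r)
-- Up-triangle (r,j): left S r j, right B r j, bottom H (r+1) j;
--   clockwise reading: (S r j , B r j , H (r+1) j).
-- Down-triangle (r,j): top H r j, right S r (j+1), left B r j;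
--   clockwise reading: (H r j , S r (j+1) , B r j).
-- Values of the functions outside the valid index ranges are irrelevant.
record Labelling : Set where
  field
    H : ℕ → ℕ → Label
    S : ℕ → ℕ → Label
    B : ℕ → ℕ → Label
open Labelling public

IsPuzzle : ℕ → Labelling → Set
IsPuzzle n P =
  (∀ r j → r < n → j ≤ r → Allowed (S P r j) (B P r j) (H P (suc r) j)) ×
  (∀ r j → r < n → j < r → Allowed (H P r j) (S P r (suc j)) (B P r j))

-- left side read clockwise, from bottom-left corner to top corner:
-- the k-th letter is the left edge of the leftmost up-triangle of strip n-1-k
LeftReads : (n : ℕ) → Labelling → Vec (Fin 3) n → Set
LeftReads n P w = ∀ (k : Fin n) → S P (n ∸ suc (toℕ k)) 0 ≡ embed (lookup w k)

-- right side read clockwise, from top corner to bottom-right corner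
RightReads : (n : ℕ) → Labelling → Vec (Fin 3) n → Set
RightReads n P w = ∀ (k : Fin n) → B P (toℕ k) (toℕ k) ≡ embed (lookup w k)

-- bottom side read counter-clockwise, from bottom-left to bottom-right corner
BottomReads : (n : ℕ) → Labelling → Vec (Fin 3) n → Set
BottomReads n P w = ∀ (k : Fin n) → H P n (toℕ k) ≡ embed (lookup w k)

SameLabels : ℕ → Labelling → Labelling → Set
SameLabels n P Q =
  (∀ r j → r ≤ n → j < r → H P r j ≡ H Q r j) ×
  (∀ r j → r < n → j ≤ r → S P r j ≡ S Q r j) ×
  (∀ r j → r < n → j ≤ r → B P r j ≡ B Q r j)

-- 012-strings for Fl(a,b;n) (0 ≤ a ≤ b ≤ n assumed separately): a zeros, b-a ones, n-b twos
Is012String : (a b n : ℕ) → Vec (Fin 3) n → Set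
Is012String a b n v =
  (count (_≟ # 0) v ≡ a) × (count (_≟ # 1) v ≡ b ∸ a) × (count (_≟ # 2) v ≡ n ∸ b)

zeroString : (a b n : ℕ) → Vec (Fin 3) n
zeroString a b n = Data.Vec.tabulate λ i → letter (toℕ i)
  where
  open import Data.Nat using (_<?_)
  open import Relation.Nullary using (does)
  open import Data.Bool using (if_then_else_)
  letter : ℕ → Fin 3
  letter i = if does (i <? a) then # 0 else (if does (i <? b) then # 1 else # 2)

-- Read a horizontal edge as a letter u over a letter l ≤ u (3 = 1 over 0, 4 = 2 over 1,
-- 5 = 2 over 0). A strip is filled from left to right: the letter s entering at its left side
-- meets the edges above it one by one and is exchanged with the top letter u of an edge exactly
-- when l ≤ s, and a finite check shows that this is the only way to label the two unit triangles
-- at that edge. Hence a puzzle is determined by its left and right sides, and it exists as soon as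
-- every strip closes, i.e. the letter arriving at the right side is ≥ the letter V r written there.
-- Bottom letters never move, and the top letters of row r are the left letters c 0, ..., c (r-1),
-- which are the r largest letters of v. Counting letters ≥ t shows that a strip can fail to close
-- only by passing an edge 2 over 1 with the letter 0 before an edge 1 over 0, and such a pair is
-- never created. In the last row the top letters are the letters of v, each at least its bottom
-- letter v j, so every edge there is the plain letter v j.

module Submission where

open import Defs
open import Data.Bool using (if_then_else_)
open import Data.Empty using (⊥; ⊥-elim)
open import Data.Fin using (Fin; toℕ; fromℕ<)
open import Data.Fin.Properties using (all?; any?; toℕ<n; toℕ-fromℕ<)
  renaming (_≟_ to _≟ᶠ_; ≤-antisym to ≤ᶠ-antisym)
open import Data.List using (List; _∷_; [])
open import Data.List.Relation.Unary.Any using (here; there)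
import Data.List.Membership.DecPropositional as DecMembership
open import Data.Nat using (ℕ; zero; suc; _+_; _∸_; _≤_; _<_; z≤n; s≤s; _<?_)
open import Data.Nat.Properties hiding (_≟_; _≤?_)
open import Data.Product using (Σ; ∃; ∃₂; _×_; _,_; proj₁; proj₂)
open import Data.Product.Properties using (≡-dec)
open import Data.Sum using (inj₁; inj₂)
open import Data.Vec using (Vec; []; _∷_; lookup; count)
open import Data.Vec.Properties using (lookup∘tabulate)
open import Relation.Binary using (tri<; tri≈; tri>)
open import Relation.Binary.PropositionalEquality
open import Relation.Nullary using (Dec; yes; no; does; ¬_; contradiction)
open import Relation.Nullary.Decidable using (decidable-stable; map′; _⊎-dec_; _×-dec_; _→-dec_; toWitness)

-- the order on letters, with both sides in the same Fin k so that literals get their size inferred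
_≤ᶠ_ : ∀ {k} → Fin k → Fin k → Set
x ≤ᶠ y = x Data.Fin.≤ y

_≤ᶠ?_ : ∀ {k} (x y : Fin k) → Dec (x ≤ᶠ y)
x ≤ᶠ? y = x Data.Fin.Properties.≤? y

pattern L0 = Fin.zero
pattern L1 = Fin.suc L0
pattern L2 = Fin.suc L1
pattern L3 = Fin.suc L2
pattern L4 = Fin.suc L3
pattern L5 = Fin.suc L4
pattern L6 = Fin.suc L5
pattern L7 = Fin.suc L6

triangles : List (Label × Label × Label)
triangles = (L0 , L0 , L0) ∷ (L1 , L1 , L1) ∷ (L2 , L2 , L2) ∷ (L1 , L0 , L3) ∷
            (L2 , L1 , L4) ∷ (L2 , L0 , L5) ∷ (L2 , L3 , L6) ∷ (L4 , L0 , L7) ∷ []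

open DecMembership (≡-dec (_≟ᶠ_ {8}) (≡-dec (_≟ᶠ_ {8}) (_≟ᶠ_ {8}))) using (_∈_; _∈?_)

basic⇒∈ : ∀ {x y z} → Basic x y z → (x , y , z) ∈ triangles
basic⇒∈ t000 = here refl
basic⇒∈ t111 = there (here refl)
basic⇒∈ t222 = there (there (here refl))
basic⇒∈ t103 = there (there (there (here refl)))
basic⇒∈ t214 = there (there (there (there (here refl))))
basic⇒∈ t205 = there (there (there (there (there (here refl)))))
basic⇒∈ t236 = there (there (there (there (there (there (here refl))))))
basic⇒∈ t407 = there (there (there (there (there (there (there (here refl)))))))

∈⇒basic : ∀ {x y z} → (x , y , z) ∈ triangles → Basic x y z
∈⇒basic (here refl) = t000
∈⇒basic (there (here refl)) = t111
∈⇒basic (there (there (here refl))) = t222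
∈⇒basic (there (there (there (here refl)))) = t103
∈⇒basic (there (there (there (there (here refl))))) = t214
∈⇒basic (there (there (there (there (there (here refl)))))) = t205
∈⇒basic (there (there (there (there (there (there (here refl))))))) = t236
∈⇒basic (there (there (there (there (there (there (there (here refl)))))))) = t407

basic? : ∀ x y z → Dec (Basic x y z)
basic? x y z = map′ ∈⇒basic basic⇒∈ ((x , y , z) ∈? triangles)

allowed? : ∀ x y z → Dec (Allowed x y z)
allowed? x y z = basic? x y z ⊎-dec basic? y z x ⊎-dec basic? z x y

allowed-rotate : ∀ {x y z} → Allowed x y z → Allowed y z x
allowed-rotate (inj₁ t) = inj₂ (inj₂ t)
allowed-rotate (inj₂ (inj₁ t)) = inj₁ t
allowed-rotate (inj₂ (inj₂ t)) = inj₂ (inj₁ t)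

-- Every pair of clockwise consecutive sides occurs in at most one unit triangle, so any two
-- sides of a unit triangle determine the third; middle x z is the side between x and z.
middle : Label → Label → Label
middle L0 L0 = L0
middle L1 L1 = L1
middle L2 L2 = L2
middle L1 L3 = L0
middle L0 L1 = L3
middle L3 L0 = L1
middle L2 L4 = L1
middle L1 L2 = L4
middle L4 L1 = L2
middle L2 L5 = L0
middle L0 L2 = L5
middle L5 L0 = L2
middle L2 L6 = L3
middle L3 L2 = L6
middle L6 L3 = L2
middle L4 L7 = L0
middle L0 L4 = L7
middle L7 L0 = L4
middle _ _ = L0

middle-unique : ∀ {x y z} → Allowed x y z → y ≡ middle x z
middle-unique =
  toWitness {a? = all? λ x → all? λ y → all? λ z → allowed? x y z →-dec y ≟ᶠ middle x z} _ _ _ _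

allowed-middle : ∀ {x y z} → Allowed x y z → Allowed x (middle x z) z
allowed-middle {x} {z = z} t = subst (λ y → Allowed x y z) (middle-unique t) t

third-unique : ∀ {x y z z'} → Allowed x y z → Allowed x y z' → z ≡ z'
third-unique t t' =
  trans (middle-unique (allowed-rotate t)) (sym (middle-unique (allowed-rotate t')))

-- The horizontal edge showing letter u over letter l ≤ u: the letter itself when u = l,
-- and 3, 4, 5 for 1 over 0, 2 over 1, 2 over 0 (the remaining pairs are junk).
cell : Fin 3 → Fin 3 → Label
cell L0 L0 = L0
cell L1 L1 = L1
cell L2 L2 = L2
cell L1 L0 = L3
cell L2 L1 = L4
cell L2 L0 = L5
cell _ _ = L0

cell-diagonal : ∀ x → cell x x ≡ embed x
cell-diagonal L0 = refl
cell-diagonal L1 = refl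
cell-diagonal L2 = refl

-- a letter s carried right along a strip meets the horizontal edge u over l
meetTop : ∀ {k} → Fin k → Fin k → Fin k → Fin k
meetTop s u l with l ≤ᶠ? s
... | yes _ = s
... | no _ = u

meetCarry : ∀ {k} → Fin k → Fin k → Fin k → Fin k
meetCarry s u l with l ≤ᶠ? s
... | yes _ = u
... | no _ = s

meet-swap : ∀ {k} {s u l : Fin k} → l ≤ᶠ s → meetTop s u l ≡ s × meetCarry s u l ≡ u
meet-swap {s = s} {l = l} l≤s with l ≤ᶠ? s
... | yes _ = refl , refl
... | no l≰s = contradiction l≤s l≰s

meet-stay : ∀ {k} {s u l : Fin k} → ¬ l ≤ᶠ s → meetTop s u l ≡ u × meetCarry s u l ≡ s
meet-stay {s = s} {l = l} l≰s with l ≤ᶠ? s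
... | yes l≤s = contradiction l≤s l≰s
... | no _ = refl , refl

meet-exchange : ∀ {k} (f : Fin k → ℕ) s u l → f (meetTop s u l) + f (meetCarry s u l) ≡ f s + f u
meet-exchange f s u l with l ≤ᶠ? s
... | yes _ = refl
... | no _ = +-comm (f u) (f s)

meet-carry-≥ : ∀ {k} {s u l : Fin k} → s ≤ᶠ u → s ≤ᶠ meetCarry s u l
meet-carry-≥ {s = s} {l = l} s≤u with l ≤ᶠ? s
... | yes _ = s≤u
... | no _ = ≤-refl

meet-carry-≤ : ∀ {k} {s u l : Fin k} → s ≤ᶠ u → meetCarry s u l ≤ᶠ u
meet-carry-≤ {s = s} {l = l} s≤u with l ≤ᶠ? s
... | yes _ = ≤-refl
... | no _ = s≤u

meet-top-≥ : ∀ {k} {s u l : Fin k} → l ≤ᶠ u → l ≤ᶠ meetTop s u l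
meet-top-≥ {s = s} {l = l} l≤u with l ≤ᶠ? s
... | yes l≤s = l≤s
... | no _ = l≤u

-- t is the letter carried along the strip below, through the edge that u over l has just become
meet-mono : ∀ {k} {s u l t : Fin k} → t ≤ᶠ s → s ≤ᶠ u →
  t ≤ᶠ meetTop s u l × meetCarry t (meetTop s u l) l ≤ᶠ meetCarry s u l
meet-mono {s = s} {u} {l} {t} t≤s s≤u with l ≤ᶠ? s
... | yes _ = t≤s , ≤-trans (meet-carry-≤ {l = l} t≤s) s≤u
... | no l≰s = ≤-trans t≤s s≤u , subst (_≤ᶠ s) (sym (proj₂ (meet-stay {u = u} l≰t))) t≤s
  where
  l≰t : ¬ l ≤ᶠ t
  l≰t l≤t = l≰s (≤-trans l≤t t≤s)

-- At a position of a strip, the up-triangle reads (s, b, h) clockwise and the down-triangle to its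
-- right reads (u over l, s', b), where h is the new horizontal edge below and b their common side.
meeting-unique : ∀ {s u l b h s'} → l ≤ᶠ u → s ≤ᶠ u →
  Allowed (embed s) b h → Allowed (cell u l) s' b →
  h ≡ cell (meetTop s u l) l × s' ≡ embed (meetCarry s u l)
meeting-unique {s} {u} {l} {b} l≤u s≤u up down =
  trans h≡ (proj₁ determined) , trans s'≡ (proj₂ determined)
  where
  h≡ = middle-unique (allowed-rotate up)
  s'≡ = middle-unique down
  -- h and s' are read off b with middle, so only the choice of b remains to be checked
  decided : ∀ s u l → l ≤ᶠ u → s ≤ᶠ u → ∀ b →
    Allowed (embed s) b (middle b (embed s)) → Allowed (cell u l) (middle (cell u l) b) b →
    middle b (embed s) ≡ cell (meetTop s u l) l × middle (cell u l) b ≡ embed (meetCarry s u l)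
  decided = toWitness {a? = all? λ s → all? λ u → all? λ l →
    l ≤ᶠ? u →-dec s ≤ᶠ? u →-dec all? λ b →
    allowed? (embed s) b (middle b (embed s)) →-dec allowed? (cell u l) (middle (cell u l) b) b →-dec
    (middle b (embed s) ≟ᶠ cell (meetTop s u l) l ×-dec middle (cell u l) b ≟ᶠ embed (meetCarry s u l))} _
  determined = decided s u l l≤u s≤u b (subst (Allowed (embed s) b) h≡ up)
                 (subst (λ x → Allowed (cell u l) x b) s'≡ down)

meeting-allowed : ∀ {s u l} → l ≤ᶠ u → s ≤ᶠ u → ∃ λ b →
  Allowed (embed s) b (cell (meetTop s u l) l) × Allowed (cell u l) (embed (meetCarry s u l)) b
meeting-allowed {s} {u} {l} = toWitness {a? = all? λ s → all? λ u → all? λ l →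
  l ≤ᶠ? u →-dec s ≤ᶠ? u →-dec any? λ b →
  allowed? (embed s) b (cell (meetTop s u l) l) ×-dec allowed? (cell u l) (embed (meetCarry s u l)) b}
  _ s u l

closing-allowed : ∀ {s l} → l ≤ᶠ s → Allowed (embed s) (embed l) (cell s l)
closing-allowed {s} {l} =
  toWitness {a? = all? λ s → all? λ l → l ≤ᶠ? s →-dec allowed? (embed s) (embed l) (cell s l)} _ s l

∑< : ℕ → (ℕ → ℕ) → ℕ
∑< zero f = 0
∑< (suc n) f = ∑< n f + f n

syntax ∑< n (λ i → e) = ∑[ i < n ] e

∑-mono : ∀ {f g} n → (∀ i → i < n → f i ≤ g i) → ∑< n f ≤ ∑< n g
∑-mono zero _ = z≤n
∑-mono (suc n) f≤g = +-mono-≤ (∑-mono n (λ i i<n → f≤g i (m<n⇒m<1+n i<n))) (f≤g n ≤-refl)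

∑-prefix : ∀ f {m n} → m ≤ n → ∑< m f ≤ ∑< n f
∑-prefix f {n = zero} z≤n = z≤n
∑-prefix f {m} {suc n} m≤1+n with m≤n⇒m<n∨m≡n m≤1+n
... | inj₂ refl = ≤-refl
... | inj₁ m<1+n = ≤-trans (∑-prefix f (≤-pred m<1+n)) (m≤m+n (∑< n f) (f n))

∑-tail : ∀ f {m n} → m ≤ n → (∀ i → m ≤ i → i < n → f i ≡ 0) → ∑< n f ≡ ∑< m f
∑-tail f {n = zero} z≤n _ = refl
∑-tail f {m} {suc n} m≤1+n vanish with m≤n⇒m<n∨m≡n m≤1+n
... | inj₂ refl = refl
... | inj₁ m<1+n = begin
  ∑< n f + f n ≡⟨ cong (∑< n f +_) (vanish n m≤n ≤-refl) ⟩
  ∑< n f + 0   ≡⟨ +-identityʳ (∑< n f) ⟩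
  ∑< n f       ≡⟨ ∑-tail f m≤n (λ i m≤i i<n → vanish i m≤i (m<n⇒m<1+n i<n)) ⟩
  ∑< m f       ∎
  where
  open ≡-Reasoning
  m≤n = ≤-pred m<1+n

∑-<⇒∃< : ∀ {f g} n → ∑< n f < ∑< n g → ∃ λ i → i < n × f i < g i
∑-<⇒∃< {f} {g} (suc n) sum< with f n <? g n
... | yes fn<gn = n , ≤-refl , fn<gn
... | no fn≮gn =
  let i , i<n , fi<gi = ∑-<⇒∃< n (+-cancelʳ-< (f n) (∑< n f) (∑< n g) earlier) in
  i , m<n⇒m<1+n i<n , fi<gi
  where
  earlier : ∑< n f + f n < ∑< n g + f n
  earlier = <-≤-trans sum< (+-monoʳ-≤ (∑< n g) (≮⇒≥ fn≮gn))

∑-≤-equal : ∀ {f g} n → (∀ i → i < n → f i ≤ g i) → ∑< n f ≡ ∑< n g →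
  ∀ i → i < n → f i ≡ g i
∑-≤-equal {f} {g} (suc n) f≤g sum≡ i i<1+n with m<1+n⇒m<n∨m≡n i<1+n
... | inj₁ i<n = ∑-≤-equal n (λ j j<n → f≤g j (m<n⇒m<1+n j<n)) front≡ i i<n
  where
  front≡ : ∑< n f ≡ ∑< n g
  front≡ = ≤-antisym (∑-mono n (λ j j<n → f≤g j (m<n⇒m<1+n j<n)))
    (+-cancelʳ-≤ (f n) (∑< n g) (∑< n f)
      (≤-trans (+-monoʳ-≤ (∑< n g) (f≤g n ≤-refl)) (≤-reflexive (sym sum≡))))
... | inj₂ refl = ≤-antisym (f≤g n ≤-refl)
  (+-cancelˡ-≤ (∑< n f) (g n) (f n)
    (≤-trans (+-monoˡ-≤ (g n) (∑-mono n (λ j j<n → f≤g j (m<n⇒m<1+n j<n)))) (≤-reflexive (sym sum≡))))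

∑-front : ∀ f n → ∑< (suc n) f ≡ f 0 + ∑[ i < n ] f (suc i)
∑-front f zero = +-comm 0 (f 0)
∑-front f (suc n) = begin
  ∑< (suc n) f + f (suc n)               ≡⟨ cong (_+ f (suc n)) (∑-front f n) ⟩
  f 0 + ∑[ i < n ] f (suc i) + f (suc n) ≡⟨ +-assoc (f 0) _ _ ⟩
  f 0 + ∑[ i < suc n ] f (suc i)         ∎
  where open ≡-Reasoning

∑-reverse : ∀ f n → ∑[ i < n ] f (n ∸ suc i) ≡ ∑< n f
∑-reverse f zero = refl
∑-reverse f (suc n) = begin
  ∑[ i < suc n ] f (suc n ∸ suc i) ≡⟨ ∑-front (λ i → f (suc n ∸ suc i)) n ⟩
  f n + ∑[ i < n ] f (n ∸ suc i)   ≡⟨ cong (f n +_) (∑-reverse f n) ⟩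
  f n + ∑< n f                     ≡⟨ +-comm (f n) (∑< n f) ⟩
  ∑< (suc n) f                     ∎
  where open ≡-Reasoning

∑-threshold : ∀ (g : ℕ → ℕ) a → (∀ i → i < a → g i ≡ 0) → (∀ i → a ≤ i → g i ≡ 1) →
  ∀ m → ∑< m g ≡ m ∸ a
∑-threshold g a below above zero = sym (0∸n≡0 a)
∑-threshold g a below above (suc m) with m <? a
... | yes m<a = begin
  ∑< m g + g m ≡⟨ cong₂ _+_ (∑-threshold g a below above m) (below m m<a) ⟩
  m ∸ a + 0    ≡⟨ +-identityʳ (m ∸ a) ⟩
  m ∸ a        ≡⟨ m≤n⇒m∸n≡0 (<⇒≤ m<a) ⟩
  0            ≡⟨ sym (m≤n⇒m∸n≡0 m<a) ⟩
  suc m ∸ a    ∎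
  where open ≡-Reasoning
... | no m≮a = begin
  ∑< m g + g m ≡⟨ cong₂ _+_ (∑-threshold g a below above m) (above m (≮⇒≥ m≮a)) ⟩
  m ∸ a + 1    ≡⟨ +-comm (m ∸ a) 1 ⟩
  1 + (m ∸ a)  ≡⟨ sym (+-∸-assoc 1 (≮⇒≥ m≮a)) ⟩
  suc m ∸ a    ∎
  where open ≡-Reasoning

atLeast : ∀ {k} → Fin k → Fin k → ℕ
atLeast t x with t ≤ᶠ? x
... | yes _ = 1
... | no _ = 0

module _ {k} {t : Fin k} where

  atLeast-≤ : ∀ {x} → t ≤ᶠ x → atLeast t x ≡ 1
  atLeast-≤ {x} t≤x with t ≤ᶠ? x
  ... | yes _ = refl
  ... | no t≰x = contradiction t≤x t≰x

  atLeast-≰ : ∀ {x} → ¬ t ≤ᶠ x → atLeast t x ≡ 0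
  atLeast-≰ {x} t≰x with t ≤ᶠ? x
  ... | yes t≤x = contradiction t≤x t≰x
  ... | no _ = refl

  atLeast≡1 : ∀ {x} → atLeast t x ≡ 1 → t ≤ᶠ x
  atLeast≡1 {x} eq with t ≤ᶠ? x
  ... | yes t≤x = t≤x
  ... | no _ with () ← eq

  atLeast-mono : ∀ {x y} → x ≤ᶠ y → atLeast t x ≤ atLeast t y
  atLeast-mono {x} {y} x≤y with t ≤ᶠ? x | t ≤ᶠ? y
  ... | yes _ | yes _ = ≤-refl
  ... | yes t≤x | no t≰y = contradiction (≤-trans t≤x x≤y) t≰y
  ... | no _ | _ = z≤n

  atLeast-< : ∀ {x y} → atLeast t x < atLeast t y → ¬ t ≤ᶠ x × t ≤ᶠ y
  atLeast-< {x} {y} lt with t ≤ᶠ? x | t ≤ᶠ? y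
  ... | no t≰x | yes t≤y = t≰x , t≤y
  ... | yes _ | yes _ = ⊥-elim (<-irrefl refl lt)
  ... | yes _ | no _ = ⊥-elim (n≮0 lt)
  ... | no _ | no _ = ⊥-elim (n≮0 lt)

atLeast-injective : ∀ {k} {x y : Fin k} → (∀ t → atLeast t x ≡ atLeast t y) → x ≡ y
atLeast-injective {x = x} {y} same = ≤ᶠ-antisym
  (atLeast≡1 (trans (sym (same x)) (atLeast-≤ ≤-refl)))
  (atLeast≡1 (trans (same y) (atLeast-≤ ≤-refl)))

-- u holds the top letters of the edges above a strip, V j is the bottom letter of column j and s
-- the letter entering from the left; sweep u s holds the top letters of the edges below the strip.
module _ {k} (V : ℕ → Fin k) where

  carry : (ℕ → Fin k) → Fin k → ℕ → Fin k
  carry u s zero = s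
  carry u s (suc j) = meetCarry (carry u s j) (u j) (V j)

  sweep : (ℕ → Fin k) → Fin k → ℕ → Fin k
  sweep u s j = meetTop (carry u s j) (u j) (V j)

  Admissible : (ℕ → Fin k) → Fin k → ℕ → Set
  Admissible u s m = ∀ j → j < m → carry u s j ≤ᶠ u j

  sweep-content : ∀ u s (f : Fin k → ℕ) j →
    ∑[ i < j ] f (sweep u s i) + f (carry u s j) ≡ f s + ∑[ i < j ] f (u i)
  sweep-content u s f zero = +-comm 0 (f s)
  sweep-content u s f (suc j) = begin
    ∑[ i < j ] f (sweep u s i) + f (sweep u s j) + f (carry u s (suc j))
      ≡⟨ +-assoc (∑[ i < j ] f (sweep u s i)) _ _ ⟩
    ∑[ i < j ] f (sweep u s i) + (f (sweep u s j) + f (carry u s (suc j)))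
      ≡⟨ cong (∑[ i < j ] f (sweep u s i) +_) (meet-exchange f (carry u s j) (u j) (V j)) ⟩
    ∑[ i < j ] f (sweep u s i) + (f (carry u s j) + f (u j))
      ≡⟨ sym (+-assoc (∑[ i < j ] f (sweep u s i)) _ _) ⟩
    ∑[ i < j ] f (sweep u s i) + f (carry u s j) + f (u j)
      ≡⟨ cong (_+ f (u j)) (sweep-content u s f j) ⟩
    f s + ∑[ i < j ] f (u i) + f (u j)
      ≡⟨ +-assoc (f s) _ _ ⟩
    f s + ∑[ i < suc j ] f (u i) ∎
    where open ≡-Reasoning

  carry-mono : ∀ {u s m} → Admissible u s m → ∀ {i j} → i ≤ j → j ≤ m → carry u s i ≤ᶠ carry u s j
  carry-mono adm {j = zero} z≤n _ = ≤-refl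
  carry-mono adm {i} {suc j} i≤1+j 1+j≤m with m≤n⇒m<n∨m≡n i≤1+j
  ... | inj₂ refl = ≤-refl
  ... | inj₁ i<1+j = ≤-trans (carry-mono adm (≤-pred i<1+j) (<⇒≤ 1+j≤m)) (meet-carry-≥ (adm j 1+j≤m))

  sweep-swapped : ∀ {u s j} → V j ≤ᶠ carry u s j → sweep u s j ≡ carry u s j
  sweep-swapped V≤carry = proj₁ (meet-swap V≤carry)

  carry-changes : ∀ {u s j} → carry u s (suc j) ≢ carry u s j →
    V j ≤ᶠ carry u s j × carry u s (suc j) ≡ u j
  carry-changes {u} {s} {j} changed with V j ≤ᶠ? carry u s j
  ... | yes V≤carry = V≤carry , refl
  ... | no _ = contradiction refl changed

  carry-sweep-≤ : ∀ {u s t m} → Admissible u s m → t ≤ᶠ s →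
    ∀ j → j ≤ m → carry (sweep u s) t j ≤ᶠ carry u s j
  carry-sweep-≤ adm t≤s zero _ = t≤s
  carry-sweep-≤ adm t≤s (suc j) 1+j≤m =
    proj₂ (meet-mono (carry-sweep-≤ adm t≤s j (<⇒≤ 1+j≤m)) (adm j 1+j≤m))

  sweep-admissible : ∀ {u s t m} → Admissible u s m → V m ≤ᶠ carry u s m → t ≤ᶠ s →
    Admissible (sweep u s) t (suc m)
  sweep-admissible {u} {s} {t} {m} adm closed t≤s j j<1+m with m<1+n⇒m<n∨m≡n j<1+m
  ... | inj₁ j<m = proj₁ (meet-mono (carry-sweep-≤ adm t≤s j (<⇒≤ j<m)) (adm j j<m))
  ... | inj₂ refl =
    subst (carry (sweep u s) t m ≤ᶠ_) (sym (sweep-swapped closed)) (carry-sweep-≤ adm t≤s m ≤-refl)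

boundary : ∀ {P : ℕ → Set} → (∀ i → Dec (P i)) → ∀ {i j} → i ≤ j → ¬ P i → P j →
  ∃ λ k → i ≤ k × k < j × ¬ P k × P (suc k)
boundary P? {j = zero} z≤n ¬Pi Pj = contradiction Pj ¬Pi
boundary P? {i} {suc j} i≤1+j ¬Pi P1+j with m≤n⇒m<n∨m≡n i≤1+j
... | inj₂ refl = contradiction P1+j ¬Pi
... | inj₁ i<1+j with P? j
...   | no ¬Pj = j , ≤-pred i<1+j , ≤-refl , ¬Pj , P1+j
...   | yes Pj =
  let k , i≤k , k<j , ¬Pk , P1+k = boundary P? (≤-pred i<1+j) ¬Pi Pj in
  k , i≤k , m<n⇒m<1+n k<j , ¬Pk , P1+k

L2≰L1 : ¬ _≤ᶠ_ {3} L2 L1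
L2≰L1 (s≤s ())

≱L1⇒≡L0 : ∀ {x : Fin 3} → ¬ L1 ≤ᶠ x → x ≡ L0
≱L1⇒≡L0 {L0} _ = refl
≱L1⇒≡L0 {Fin.suc _} L1≰x = contradiction (s≤s z≤n) L1≰x

≰L1⇒≡L2 : ∀ {x : Fin 3} → ¬ x ≤ᶠ L1 → x ≡ L2
≰L1⇒≡L2 {L0} x≰L1 = contradiction z≤n x≰L1
≰L1⇒≡L2 {L1} x≰L1 = contradiction ≤-refl x≰L1
≰L1⇒≡L2 {L2} _ = refl

≤L2 : ∀ (x : Fin 3) → x ≤ᶠ L2
≤L2 x = ≤-pred (toℕ<n x)

L2≤⇒≡L2 : ∀ {x : Fin 3} → L2 ≤ᶠ x → x ≡ L2
L2≤⇒≡L2 {x} L2≤x = ≤ᶠ-antisym (≤L2 x) L2≤x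

L1-only : ∀ {x : Fin 3} → L1 ≤ᶠ x → ¬ L2 ≤ᶠ x → x ≡ L1
L1-only {L1} _ _ = refl
L1-only {L2} _ L2≰x = contradiction ≤-refl L2≰x

descent : ∀ {x y z : Fin 3} → ¬ y ≤ᶠ x → ¬ z ≤ᶠ y → x ≡ L0 × y ≡ L1 × z ≡ L2
descent {y = L0} y≰x _ = contradiction z≤n y≰x
descent {y = L1} y≰x z≰y = ≱L1⇒≡L0 y≰x , refl , ≰L1⇒≡L2 z≰y
descent {y = L2} {z} _ z≰y = contradiction (≤L2 z) z≰y

module _ (V : ℕ → Fin 3) where

  -- edge i shows 2 over 1 (label 4) and edge j shows 1 over 0 (label 3)
  Inversion : (ℕ → Fin 3) → ℕ → ℕ → Set
  Inversion u i j = (u i ≡ L2 × V i ≡ L1) × (u j ≡ L1 × V j ≡ L0)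

  NoInversion : (ℕ → Fin 3) → ℕ → Set
  NoInversion u m = ∀ {i j} → i < j → j < m → ¬ Inversion u i j

  sweep-noInversion : ∀ {u s m} → Admissible V u s m → NoInversion u m →
    NoInversion (sweep V u s) (suc m)
  sweep-noInversion {u} {s} {m} adm none {i} {j} i<j j<1+m ((top-i , bot-i) , (top-j , bot-j)) =
    at-i (V i ≤ᶠ? carry V u s i)
    where
    mono = carry-mono V adm
    j≤m = ≤-pred j<1+m
    carry-j : carry V u s j ≡ L1
    carry-j = trans (sym (sweep-swapped V (subst (_≤ᶠ carry V u s j) (sym bot-j) z≤n))) top-j
    at-i : Dec (V i ≤ᶠ carry V u s i) → ⊥
    at-i (yes swapped) = L2≰L1 (subst₂ _≤ᶠ_ carry-i carry-j (mono (<⇒≤ i<j) j≤m))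
      where
      carry-i = trans (sym (sweep-swapped V swapped)) top-i
    at-i (no stayed) =
      rise-at (boundary (λ x → L1 ≤ᶠ? carry V u s x) i<j ¬rise₀ (subst (L1 ≤ᶠ_) (sym carry-j) ≤-refl))
      where
      -- the carry is 0 after edge i, which it passes without exchange, and 1 at edge j
      ¬rise₀ : ¬ L1 ≤ᶠ carry V u s (suc i)
      ¬rise₀ L1≤ = stayed
        (subst (_≤ᶠ carry V u s i) (sym bot-i) (subst (L1 ≤ᶠ_) (proj₂ (meet-stay stayed)) L1≤))
      rise-at : (∃ λ k → suc i ≤ k × k < j × ¬ L1 ≤ᶠ carry V u s k × L1 ≤ᶠ carry V u s (suc k)) → ⊥
      rise-at (k , i<k , k<j , ¬rise , rise) =
        none i<k (<-≤-trans k<j j≤m)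
          ((trans (sym (proj₁ (meet-stay stayed))) top-i , bot-i) , (top-k , bot-k))
        where
        swap-k = carry-changes V (λ eq → ¬rise (subst (L1 ≤ᶠ_) eq rise))
        bot-k = ≱L1⇒≡L0 (λ L1≤V → ¬rise (≤-trans L1≤V (proj₁ swap-k)))
        top-k = ≤ᶠ-antisym
          (subst₂ _≤ᶠ_ (proj₂ swap-k) carry-j (mono k<j j≤m))
          (subst (L1 ≤ᶠ_) (proj₂ swap-k) rise)

-- c r and V r are the letters on the left and right side of strip r (row r counted from the top)
module Canonical (n : ℕ) (c V : ℕ → Fin 3)
  (c-antitone : ∀ r → c (suc r) ≤ᶠ c r)
  (same-content : ∀ t → ∑[ i < n ] atLeast t (c i) ≡ ∑[ i < n ] atLeast t (V i)) where

  -- row 0 is the apex and has no horizontal edges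
  line : ℕ → ℕ → Fin 3
  line zero _ = L0
  line (suc r) = sweep V (line r) (c r)

  carried : ℕ → ℕ → Fin 3
  carried r = carry V (line r) (c r)

  record Invariant (r : ℕ) : Set where
    field
      admissible : Admissible V (line r) (c r) r
      above-bottom : ∀ j → j < r → V j ≤ᶠ line r j
      content : ∀ (f : Fin 3 → ℕ) → ∑[ j < r ] f (line r j) ≡ ∑[ i < r ] f (c i)
      no-inversion : NoInversion V (line r) r
  open Invariant

  c-antitone* : ∀ {r i} → r ≤ i → c i ≤ᶠ c r
  c-antitone* {i = zero} z≤n = ≤-refl
  c-antitone* {r} {suc i} r≤1+i with m≤n⇒m<n∨m≡n r≤1+i
  ... | inj₂ refl = ≤-refl
  ... | inj₁ r<1+i = ≤-trans (c-antitone i) (c-antitone* (≤-pred r<1+i))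

  invariant-suc : ∀ {r} → Invariant r → V r ≤ᶠ carried r r → Invariant (suc r)
  invariant-suc {r} inv closed = record
    { admissible = sweep-admissible V (admissible inv) closed (c-antitone r)
    ; above-bottom = above
    ; content = total
    ; no-inversion = sweep-noInversion V (admissible inv) (no-inversion inv)
    }
    where
    last : line (suc r) r ≡ carried r r
    last = sweep-swapped V closed
    above : ∀ j → j < suc r → V j ≤ᶠ line (suc r) j
    above j j<1+r with m<1+n⇒m<n∨m≡n j<1+r
    ... | inj₁ j<r = meet-top-≥ (above-bottom inv j j<r)
    ... | inj₂ refl = subst (V r ≤ᶠ_) (sym last) closed
    total : ∀ (f : Fin 3 → ℕ) → ∑[ j < suc r ] f (line (suc r) j) ≡ ∑[ i < suc r ] f (c i)
    total f = begin
      ∑[ j < r ] f (line (suc r) j) + f (line (suc r) r)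
        ≡⟨ cong (λ x → ∑[ j < r ] f (line (suc r) j) + f x) last ⟩
      ∑[ j < r ] f (line (suc r) j) + f (carried r r) ≡⟨ sweep-content V (line r) (c r) f r ⟩
      f (c r) + ∑[ j < r ] f (line r j)            ≡⟨ cong (f (c r) +_) (content inv f) ⟩
      f (c r) + ∑[ i < r ] f (c i)                 ≡⟨ +-comm (f (c r)) _ ⟩
      ∑[ i < suc r ] f (c i)                       ∎
      where open ≡-Reasoning

  -- Row r holds the letters c 0, ..., c (r-1) over V 0, ..., V (r-1). When c r < t ≤ V r, the
  -- first r letters of c contain all of its letters ≥ t, hence more of them than V 0, ..., V (r-1).
  surplus : ∀ {r t} → r < n → Invariant r → ¬ t ≤ᶠ c r → t ≤ᶠ V r →
    ∃ λ j → j < r × ¬ t ≤ᶠ V j × t ≤ᶠ line r j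
  surplus {r} {t} r<n inv t≰c t≤V =
    let j , j<r , fewer = ∑-<⇒∃< {λ j → f (V j)} {λ j → f (line r j)} r deficit in j , j<r , atLeast-< fewer
    where
    f = atLeast t
    deficit : ∑[ j < r ] f (V j) < ∑[ j < r ] f (line r j)
    deficit = begin-strict
      ∑[ j < r ] f (V j)         <⟨ m<m+n _ (s≤s z≤n) ⟩
      ∑[ j < r ] f (V j) + 1     ≡⟨ cong (∑[ j < r ] f (V j) +_) (sym (atLeast-≤ t≤V)) ⟩
      ∑[ j < suc r ] f (V j)     ≤⟨ ∑-prefix (λ j → f (V j)) r<n ⟩
      ∑[ j < n ] f (V j)         ≡⟨ sym (same-content t) ⟩
      ∑[ i < n ] f (c i)         ≡⟨ ∑-tail (λ i → f (c i)) (<⇒≤ r<n) vanish ⟩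
      ∑[ i < r ] f (c i)         ≡⟨ sym (content inv f) ⟩
      ∑[ j < r ] f (line r j)    ∎
      where
      open ≤-Reasoning
      vanish : ∀ i → r ≤ i → i < n → f (c i) ≡ 0
      vanish i r≤i _ = atLeast-≰ (λ t≤ci → t≰c (≤-trans t≤ci (c-antitone* r≤i)))

  module Stuck {r} (r<n : r < n) (inv : Invariant r) (stuck : ¬ V r ≤ᶠ carried r r) where

    mono = carry-mono V (admissible inv)

    exchanged : ∀ {j} → j < r → V j ≤ᶠ carried r j → line r j ≤ᶠ carried r r
    exchanged {j} j<r swap = subst (_≤ᶠ carried r r) (proj₂ (meet-swap swap)) (mono j<r ≤-refl)

    ordered : ∀ {j j'} → j < r → carried r j ≡ L0 → V j ≡ L1 → V j' ≡ L0 →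
      L1 ≤ᶠ carried r (suc j') → j < j'
    ordered {j} {j'} j<r carried≡0 Vj≡1 Vj'≡0 rise with <-cmp j j'
    ... | tri< j<j' _ _ = j<j'
    ... | tri≈ _ refl _ = contradiction (trans (sym Vj≡1) Vj'≡0) λ ()
    ... | tri> _ _ j'<j =
      contradiction (subst (L1 ≤ᶠ_) carried≡0 (≤-trans rise (mono j'<j (<⇒≤ j<r)))) λ ()

    -- Given the edge j showing 2 over 1 that the carry passes as 0, the carry must still reach 1
    -- before strip r ends, which takes an edge showing 1 over 0 to the right of j.
    inversion-after : ∀ {j} → j < r → line r j ≡ L2 × V j ≡ L1 → carried r j ≡ L0 → V r ≡ L2 →
      ∃₂ λ i j → i < j × j < r × Inversion V (line r) i j
    inversion-after {j} j<r four carried≡0 Vr≡2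
      with surplus r<n inv
             (λ L1≤c → contradiction (subst (L1 ≤ᶠ_) carried≡0 (≤-trans L1≤c (mono z≤n (<⇒≤ j<r)))) λ ())
             (subst (L1 ≤ᶠ_) (sym Vr≡2) (s≤s z≤n))
    ... | j' , j'<r , L1≰V , L1≤line =
      j , j' , ordered j<r carried≡0 (proj₂ four) bot (subst (L1 ≤ᶠ_) (sym lifted) L1≤line) ,
      j'<r , four , (top , bot)
      where
      bot = ≱L1⇒≡L0 L1≰V
      swap : V j' ≤ᶠ carried r j'
      swap = subst (_≤ᶠ carried r j') (sym bot) z≤n
      lifted : carried r (suc j') ≡ line r j'
      lifted = proj₂ (meet-swap swap)
      top = L1-only L1≤line λ L2≤line →
        stuck (subst (_≤ᶠ carried r r) (sym Vr≡2) (≤-trans L2≤line (exchanged j'<r swap)))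

    -- Some edge shows a letter ≥ V r over one < V r; an exchange there would close the strip, so
    -- the carry passes it below its bottom letter, which forces 2 over 1 passed by 0.
    inversion : ∃₂ λ i j → i < j × j < r × Inversion V (line r) i j
    inversion with surplus r<n inv (λ V≤c → stuck (≤-trans V≤c (mono z≤n ≤-refl))) ≤-refl
    ... | j , j<r , Vr≰Vj , Vr≤line = found (descent passed Vr≰Vj)
      where
      passed : ¬ V j ≤ᶠ carried r j
      passed swap = stuck (≤-trans Vr≤line (exchanged j<r swap))
      found : carried r j ≡ L0 × V j ≡ L1 × V r ≡ L2 →
        ∃₂ λ i j → i < j × j < r × Inversion V (line r) i j
      found (carried≡0 , Vj≡1 , Vr≡2) =
        inversion-after j<r (L2≤⇒≡L2 (subst (_≤ᶠ line r j) Vr≡2 Vr≤line) , Vj≡1) carried≡0 Vr≡2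

  closes : ∀ {r} → r < n → Invariant r → V r ≤ᶠ carried r r
  closes {r} r<n inv =
    decidable-stable (V r ≤ᶠ? carried r r) λ stuck → absurd (Stuck.inversion r<n inv stuck)
    where
    absurd : ¬ ∃₂ λ i j → i < j × j < r × Inversion V (line r) i j
    absurd (i , j , i<j , j<r , inverted) = no-inversion inv i<j j<r inverted

  invariant : ∀ {r} → r ≤ n → Invariant r
  invariant {zero} _ = record
    { admissible = λ _ () ; above-bottom = λ _ () ; content = λ _ → refl ; no-inversion = λ _ () }
  invariant {suc r} r<n = invariant-suc inv (closes r<n inv)
    where inv = invariant (<⇒≤ r<n)

  -- Row n carries exactly the letters of V, each above its own bottom letter, so it is V.
  line-bottom : ∀ {j} → j < n → line n j ≡ V j
  line-bottom {j} j<n = atLeast-injective λ t →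
    sym (∑-≤-equal {λ i → atLeast t (V i)} {λ i → atLeast t (line n i)} n
           (λ i i<n → atLeast-mono (above-bottom inv i i<n)) (sums t) j j<n)
    where
    inv = invariant ≤-refl
    sums : ∀ t → ∑[ i < n ] atLeast t (V i) ≡ ∑[ i < n ] atLeast t (line n i)
    sums t = trans (sym (same-content t)) (sym (content inv (atLeast t)))

  canonical : Labelling
  canonical = record
    { H = λ r j → cell (line r j) (V j)
    ; S = λ r j → embed (carried r j)
    ; B = λ r j → middle (embed (carried r j)) (cell (line (suc r) j) (V j))
    }

  closing : ∀ {r} → r < n → Allowed (S canonical r r) (embed (V r)) (H canonical (suc r) r)
  closing {r} r<n = subst (λ x → Allowed (embed (carried r r)) (embed (V r)) (cell x (V r)))
    (sym (sweep-swapped V closed)) (closing-allowed closed)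
    where closed = closes r<n (invariant (<⇒≤ r<n))

  meeting : ∀ {r j} → r < n → j < r → ∃ λ b →
    Allowed (S canonical r j) b (H canonical (suc r) j) ×
    Allowed (H canonical r j) (S canonical r (suc j)) b
  meeting {r} {j} r<n j<r = meeting-allowed (above-bottom inv j j<r) (admissible inv j j<r)
    where inv = invariant (<⇒≤ r<n)

  canonical-puzzle : IsPuzzle n canonical
  canonical-puzzle = up , down
    where
    up : ∀ r j → r < n → j ≤ r → Allowed (S canonical r j) (B canonical r j) (H canonical (suc r) j)
    up r j r<n j≤r with m≤n⇒m<n∨m≡n j≤r
    ... | inj₁ j<r = allowed-middle (proj₁ (proj₂ (meeting r<n j<r)))
    ... | inj₂ refl = allowed-middle (closing r<n)
    down : ∀ r j → r < n → j < r → Allowed (H canonical r j) (S canonical r (suc j)) (B canonical r j)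
    down r j r<n j<r =
      let _ , up , down = meeting r<n j<r in subst (Allowed _ _) (middle-unique up) down

  canonical-right : ∀ {r} → r < n → B canonical r r ≡ embed (V r)
  canonical-right r<n = sym (middle-unique (closing r<n))

  canonical-bottom : ∀ {j} → j < n → H canonical n j ≡ embed (V j)
  canonical-bottom {j} j<n = trans (cong (λ x → cell x (V j)) (line-bottom j<n)) (cell-diagonal (V j))

  module _ (Q : Labelling) (puzzle : IsPuzzle n Q)
    (left : ∀ r → r < n → S Q r 0 ≡ embed (c r)) (right : ∀ r → r < n → B Q r r ≡ embed (V r)) where

    RowAgrees : ℕ → Set
    RowAgrees r = ∀ j → j < r → H Q r j ≡ H canonical r j

    S-agrees : ∀ {r} → r < n → RowAgrees r → ∀ j → j ≤ r → S Q r j ≡ S canonical r j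
    meeting-agrees : ∀ {r j} → r < n → RowAgrees r → j < r →
      H Q (suc r) j ≡ H canonical (suc r) j × S Q r (suc j) ≡ S canonical r (suc j)

    S-agrees r<n agree zero _ = left _ r<n
    S-agrees r<n agree (suc j) j<r = proj₂ (meeting-agrees r<n agree j<r)

    meeting-agrees {r} {j} r<n agree j<r =
      meeting-unique (above-bottom inv j j<r) (admissible inv j j<r) up down
      where
      inv = invariant (<⇒≤ r<n)
      up = subst (λ x → Allowed x (B Q r j) (H Q (suc r) j)) (S-agrees r<n agree j (<⇒≤ j<r))
             (proj₁ puzzle r j r<n (<⇒≤ j<r))
      down = subst (λ x → Allowed x (S Q r (suc j)) (B Q r j)) (agree j j<r) (proj₂ puzzle r j r<n j<r)

    row-agrees : ∀ {r} → r ≤ n → RowAgrees r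
    row-agrees {zero} _ _ ()
    row-agrees {suc r} r<n j j<1+r with m<1+n⇒m<n∨m≡n j<1+r
    ... | inj₁ j<r = proj₁ (meeting-agrees r<n (row-agrees (<⇒≤ r<n)) j<r)
    ... | inj₂ refl = third-unique up (closing r<n)
      where
      up = subst₂ (λ x y → Allowed x y (H Q (suc r) r))
             (S-agrees r<n (row-agrees (<⇒≤ r<n)) r ≤-refl) (right r r<n) (proj₁ puzzle r r r<n ≤-refl)

    canonical-unique : SameLabels n canonical Q
    canonical-unique =
      (λ r j r≤n j<r → sym (row-agrees r≤n j j<r)) ,
      (λ r j r<n j≤r → sym (S-agrees r<n (row-agrees (<⇒≤ r<n)) j j≤r)) ,
      (λ r j r<n j≤r → sym (B-agrees r<n j≤r))
      where
      B-agrees : ∀ {r j} → r < n → j ≤ r → B Q r j ≡ B canonical r j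
      B-agrees {r} {j} r<n j≤r = trans (middle-unique (proj₁ puzzle r j r<n j≤r))
        (cong₂ middle (S-agrees r<n (row-agrees (<⇒≤ r<n)) j j≤r) (row-agrees r<n j (s≤s j≤r)))

-- The letter at position i of zeroString a b n, with the two comparisons as arguments so that
-- it can be analysed by matching on them; the body is literally the one in zeroString.
sortedLetterBy : ∀ {i a b : ℕ} → Dec (i < a) → Dec (i < b) → Fin 3
sortedLetterBy i<a? i<b? = if does i<a? then L0 else (if does i<b? then L1 else L2)

sortedLetter : ℕ → ℕ → ℕ → Fin 3
sortedLetter a b i = sortedLetterBy (i <? a) (i <? b)

lookup-zeroString : ∀ a b n (k : Fin n) → lookup (zeroString a b n) k ≡ sortedLetter a b (toℕ k)
lookup-zeroString a b n = lookup∘tabulate _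

sortedLetter-mono : ∀ a b {i i'} → i ≤ i' → sortedLetter a b i ≤ᶠ sortedLetter a b i'
sortedLetter-mono a b {i} {i'} i≤i' = by (i <? a) (i <? b) (i' <? a) (i' <? b)
  where
  by : (d : Dec (i < a)) (e : Dec (i < b)) (d' : Dec (i' < a)) (e' : Dec (i' < b)) →
    sortedLetterBy d e ≤ᶠ sortedLetterBy d' e'
  by (yes _) _ _ _ = z≤n
  by (no i≮a) _ (yes i'<a) _ = contradiction (≤-<-trans i≤i' i'<a) i≮a
  by (no _) (yes _) (no _) (yes _) = ≤-refl
  by (no _) (yes _) (no _) (no _) = s≤s z≤n
  by (no _) (no i≮b) (no _) (yes i'<b) = contradiction (≤-<-trans i≤i' i'<b) i≮b
  by (no _) (no _) (no _) (no _) = ≤-refl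

count-sorted₁ : ∀ a b m → ∑[ i < m ] atLeast L1 (sortedLetter a b i) ≡ m ∸ a
count-sorted₁ a b = ∑-threshold _ a (λ i → below (i <? a) (i <? b)) (λ i → above (i <? a) (i <? b))
  where
  below : ∀ {i} (d : Dec (i < a)) (e : Dec (i < b)) → i < a → atLeast L1 (sortedLetterBy d e) ≡ 0
  below (yes _) _ _ = refl
  below (no i≮a) _ i<a = contradiction i<a i≮a
  above : ∀ {i} (d : Dec (i < a)) (e : Dec (i < b)) → a ≤ i → atLeast L1 (sortedLetterBy d e) ≡ 1
  above (yes i<a) _ a≤i = contradiction i<a (≤⇒≯ a≤i)
  above (no _) (yes _) _ = refl
  above (no _) (no _) _ = refl

count-sorted₂ : ∀ {a b} → a ≤ b → ∀ m → ∑[ i < m ] atLeast L2 (sortedLetter a b i) ≡ m ∸ b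
count-sorted₂ {a} {b} a≤b = ∑-threshold _ b (λ i → below (i <? a) (i <? b)) (λ i → above (i <? a) (i <? b))
  where
  below : ∀ {i} (d : Dec (i < a)) (e : Dec (i < b)) → i < b → atLeast L2 (sortedLetterBy d e) ≡ 0
  below (yes _) _ _ = refl
  below (no _) (yes _) _ = refl
  below (no _) (no i≮b) i<b = contradiction i<b i≮b
  above : ∀ {i} (d : Dec (i < a)) (e : Dec (i < b)) → b ≤ i → atLeast L2 (sortedLetterBy d e) ≡ 1
  above (yes i<a) _ b≤i = contradiction (<-≤-trans i<a a≤b) (≤⇒≯ b≤i)
  above (no _) (yes i<b) b≤i = contradiction i<b (≤⇒≯ b≤i)
  above (no _) (no _) _ = refl

-- reading a vector at a natural-number position, with junk L0 past its end
_!_ : ∀ {m} → Vec (Fin 3) m → ℕ → Fin 3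
[] ! _ = L0
(x ∷ _) ! zero = x
(_ ∷ w) ! suc i = w ! i

lookup-! : ∀ {m} (w : Vec (Fin 3) m) k → lookup w k ≡ w ! toℕ k
lookup-! (x ∷ w) Fin.zero = refl
lookup-! (x ∷ w) (Fin.suc k) = lookup-! w k

count-atLeast₁ : ∀ {m} (w : Vec (Fin 3) m) →
  ∑[ i < m ] atLeast L1 (w ! i) ≡ count (_≟ᶠ L1) w + count (_≟ᶠ L2) w
count-atLeast₁ [] = refl
count-atLeast₁ {suc m} (x ∷ w) = trans (∑-front (λ i → atLeast L1 ((x ∷ w) ! i)) m) (step x)
  where
  step : ∀ y → atLeast L1 y + ∑[ i < m ] atLeast L1 (w ! i) ≡
    count (_≟ᶠ L1) (y ∷ w) + count (_≟ᶠ L2) (y ∷ w)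
  step L0 = count-atLeast₁ w
  step L1 = cong suc (count-atLeast₁ w)
  step L2 = trans (cong suc (count-atLeast₁ w)) (sym (+-suc _ _))

count-atLeast₂ : ∀ {m} (w : Vec (Fin 3) m) → ∑[ i < m ] atLeast L2 (w ! i) ≡ count (_≟ᶠ L2) w
count-atLeast₂ [] = refl
count-atLeast₂ {suc m} (x ∷ w) = trans (∑-front (λ i → atLeast L2 ((x ∷ w) ! i)) m) (step x)
  where
  step : ∀ y → atLeast L2 y + ∑[ i < m ] atLeast L2 (w ! i) ≡ count (_≟ᶠ L2) (y ∷ w)
  step L0 = count-atLeast₂ w
  step L1 = count-atLeast₂ w
  step L2 = cong suc (count-atLeast₂ w)

sorted-content : ∀ {a b n} → a ≤ b → b ≤ n → (v : Vec (Fin 3) n) → Is012String a b n v →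
  ∀ t → ∑[ i < n ] atLeast t (sortedLetter a b (n ∸ suc i)) ≡ ∑[ i < n ] atLeast t (v ! i)
sorted-content _ _ _ _ L0 = refl
sorted-content {a} {b} {n} a≤b b≤n v (_ , ones , twos) L1 = begin
  ∑[ i < n ] atLeast L1 (sortedLetter a b (n ∸ suc i))
    ≡⟨ ∑-reverse (λ i → atLeast L1 (sortedLetter a b i)) n ⟩
  ∑[ i < n ] atLeast L1 (sortedLetter a b i)           ≡⟨ count-sorted₁ a b n ⟩
  n ∸ a                                                 ≡⟨ split ⟩
  (b ∸ a) + (n ∸ b)                                     ≡⟨ sym (cong₂ _+_ ones twos) ⟩
  count (_≟ᶠ L1) v + count (_≟ᶠ L2) v                   ≡⟨ sym (count-atLeast₁ v) ⟩
  ∑[ i < n ] atLeast L1 (v ! i)                         ∎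
  where
  open ≡-Reasoning
  split : n ∸ a ≡ (b ∸ a) + (n ∸ b)
  split = begin
    n ∸ a             ≡⟨ cong (_∸ a) (sym (m∸n+n≡m b≤n)) ⟩
    (n ∸ b + b) ∸ a   ≡⟨ +-∸-assoc (n ∸ b) a≤b ⟩
    n ∸ b + (b ∸ a)   ≡⟨ +-comm (n ∸ b) (b ∸ a) ⟩
    (b ∸ a) + (n ∸ b) ∎
sorted-content {a} {b} {n} a≤b b≤n v (_ , _ , twos) L2 = begin
  ∑[ i < n ] atLeast L2 (sortedLetter a b (n ∸ suc i))
    ≡⟨ ∑-reverse (λ i → atLeast L2 (sortedLetter a b i)) n ⟩
  ∑[ i < n ] atLeast L2 (sortedLetter a b i)           ≡⟨ count-sorted₂ a≤b n ⟩
  n ∸ b                                                 ≡⟨ sym twos ⟩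
  count (_≟ᶠ L2) v                                      ≡⟨ sym (count-atLeast₂ v) ⟩
  ∑[ i < n ] atLeast L2 (v ! i)                         ∎
  where open ≡-Reasoning

∀-Fin⇒∀-< : ∀ {n} {P : ℕ → Set} → (∀ (k : Fin n) → P (toℕ k)) → ∀ i → i < n → P i
∀-Fin⇒∀-< {P = P} all i i<n = subst P (toℕ-fromℕ< i<n) (all (fromℕ< i<n))

∀-<⇒∀-Fin : ∀ {n} {P : ℕ → Set} → (∀ i → i < n → P i) → ∀ (k : Fin n) → P (toℕ k)
∀-<⇒∀-Fin all k = all (toℕ k) (toℕ<n k)

∸-suc-< : ∀ {n r} → r < n → n ∸ suc r < n
∸-suc-< {suc n} {r} _ = s≤s (m∸n≤m n r)

∸-suc-involutive : ∀ {n r} → r < n → n ∸ suc (n ∸ suc r) ≡ r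
∸-suc-involutive {suc n} (s≤s r≤n) = m∸[m∸n]≡n r≤n

module _ (a b n : ℕ) (L : Labelling) where

  leftReads⇒ : LeftReads n L (zeroString a b n) →
    ∀ r → r < n → S L r 0 ≡ embed (sortedLetter a b (n ∸ suc r))
  leftReads⇒ reads r r<n = subst (λ x → S L x 0 ≡ embed (sortedLetter a b (n ∸ suc r)))
    (∸-suc-involutive r<n) (by-position (n ∸ suc r) (∸-suc-< r<n))
    where
    by-position : ∀ i → i < n → S L (n ∸ suc i) 0 ≡ embed (sortedLetter a b i)
    by-position = ∀-Fin⇒∀-< {P = λ i → S L (n ∸ suc i) 0 ≡ embed (sortedLetter a b i)}
      (λ k → trans (reads k) (cong embed (lookup-zeroString a b n k)))

  leftReads⇐ : (∀ r → r < n → S L r 0 ≡ embed (sortedLetter a b (n ∸ suc r))) →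
    LeftReads n L (zeroString a b n)
  leftReads⇐ by-row k = trans (by-row (n ∸ suc (toℕ k)) (∸-suc-< (toℕ<n k)))
    (cong embed (trans (cong (sortedLetter a b) (∸-suc-involutive (toℕ<n k))) (sym (lookup-zeroString a b n k))))

module _ {n} (L : Labelling) (v : Vec (Fin 3) n) where

  rightReads⇒ : RightReads n L v → ∀ r → r < n → B L r r ≡ embed (v ! r)
  rightReads⇒ reads = ∀-Fin⇒∀-< {P = λ r → B L r r ≡ embed (v ! r)}
    (λ k → trans (reads k) (cong embed (lookup-! v k)))

  rightReads⇐ : (∀ r → r < n → B L r r ≡ embed (v ! r)) → RightReads n L v
  rightReads⇐ by-row k = trans (∀-<⇒∀-Fin by-row k) (cong embed (sym (lookup-! v k)))

  bottomReads⇐ : (∀ j → j < n → H L n j ≡ embed (v ! j)) → BottomReads n L v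
  bottomReads⇐ by-column k = trans (∀-<⇒∀-Fin by-column k) (cong embed (sym (lookup-! v k)))

corollary3p2 : (a b n : ℕ) → a ≤ b → b ≤ n → (v : Vec (Fin 3) n) → Is012String a b n v →
    Σ Labelling (λ P →
      (IsPuzzle n P × LeftReads n P (zeroString a b n) × RightReads n P v) ×
      (∀ Q → IsPuzzle n Q → LeftReads n Q (zeroString a b n) → RightReads n Q v → SameLabels n P Q) ×
      BottomReads n P v)
corollary3p2 a b n a≤b b≤n v counts =
  canonical ,
  (canonical-puzzle ,
   leftReads⇐ a b n canonical (λ _ _ → refl) ,
   rightReads⇐ canonical v (λ _ → canonical-right)) ,
  (λ Q puzzle left right → canonical-unique Q puzzle (leftReads⇒ a b n Q left) (rightReads⇒ Q v right)) ,
  bottomReads⇐ canonical v (λ _ → canonical-bottom)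
  where
  open Canonical n (λ r → sortedLetter a b (n ∸ suc r)) (v !_)
    (λ r → sortedLetter-mono a b (∸-monoʳ-≤ n (n≤1+n (suc r)))) (sorted-content a≤b b≤n v counts)
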